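{- For any integer posets $\prec,\lhd\in\mathrm{IPos}$: (i) if $\mathrm{Sh}(\prec,\lhd)\cap\mathrm{WOFP}\neq\varnothing$, then $\prec\in\mathrm{WOFP}$ and $\lhd\in\mathrm{WOFP}$; (ii) if $\prec\in\mathrm{WOFP}$ and $\lhd\in\mathrm{WOFP}$, then $\prec\star\lhd\subseteq\mathrm{WOFP}$. Consequently, the linear span of $\{F_\prec:\prec\in\mathrm{IPos}\setminus\mathrm{WOFP}\}$ is a Hopf ideal of $(\mathbb{K}\mathrm{IPos},\cdot,\Delta)$, and the quotient is a Hopf algebra $(\mathbb{K}\mathrm{WOFP}^{\mathrm{quo}},\cdot,\Delta)$ on faces of the permutahedron.
   Context: For $n \ge 0$ let $[n]=\{1,\dots,n\}$. An integer relation of size $n$ is a reflexive relation on $[n]$; an integer poset is an antisymmetric transitive one; $\mathrm{IPos}=\bigsqcup_n\mathrm{IPos}_n$. For an ordered partition $\pi=(B_1|\dots|B_k)$ of $[n]$ into nonempty blocks, the poset $\prec_\pi$ on $[n]$ is defined by $u\prec_\pi v$ iff $u=v$ or the block containing $u$ comes strictly before the block containing $v$. $\mathrm{WOFP}_n=\{\prec_\pi:\pi\text{ ordered partition of }[n]\}$ and $\mathrm{WOFP}=\bigsqcup_n\mathrm{WOFP}_n$. For $R$ of size $n$ and $X=\{x_1<\dots<x_k\}\subseteq[n]$, $R_X=\{(i,j)\in[k]^2:(x_i,x_j)\in R\}$. For $S$ of size $n$, $m\ge0$: $\overline{S}=\{(m+i,m+j):(i,j)\in S\}$, $\overline{[n]}=\{m+1,\dots,m+n\}$;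 for $R$ of size $m$, $\mathrm{Sh}(R,S)$ is the set of all $R\cup\overline{S}\cup I\cup D$ with $I\subseteq[m]\times\overline{[n]}$, $D\subseteq\overline{[n]}\times[m]$. A total cut of $T$ on $[p]$ is a partition $[p]=X\sqcup Y$ with $(x,y)\in T$, $(y,x)\notin T$ for all $x\in X,y\in Y$; $R\star S$ is the set of relations $T$ on $[m+n]$ admitting a total cut $(X,Y)$ with $T_X=R$, $T_Y=S$. $(\mathbb{K}\mathrm{IPos},\cdot,\Delta)$ has basis $(F_\prec)_{\prec\in\mathrm{IPos}}$, product $F_\prec\cdot F_\lhd=\sum_{T\in\mathrm{Sh}(\prec,\lhd)\cap\mathrm{IPos}}F_T$, coproduct $\Delta(F_T)=\sum_{(R,S):T\in R\star S}F_R\otimes F_S$. -}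

module Defs where

open import Data.Nat using (ℕ; _+_)
open import Data.Fin using (Fin; _<_; _↑ˡ_; _↑ʳ_)
open import Data.Bool using (Bool; true; false; not)
open import Data.Product using (Σ; ∃; ∃-syntax; _×_; _,_)
open import Data.Sum using (_⊎_)
open import Function using (_∘_)
open import Function.Definitions using (Surjective)
open import Relation.Binary.PropositionalEquality using (_≡_)

Rel : ℕ → Set
Rel n = Fin n → Fin n → Bool

_≐_ : ∀ {n} → Rel n → Rel n → Set
R ≐ S = ∀ i j → R i j ≡ S i j

Reflexive : ∀ {n} → Rel n → Set
Reflexive R = ∀ i → R i i ≡ true

Antisymmetric : ∀ {n} → Rel n → Set
Antisymmetric R = ∀ i j → R i j ≡ true → R j i ≡ true → i ≡ j

Transitive : ∀ {n} → Rel n → Set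
Transitive R = ∀ i j k → R i j ≡ true → R j k ≡ true → R i k ≡ true

IPos : ∀ {n} → Rel n → Set
IPos R = Reflexive R × Antisymmetric R × Transitive R

-- An ordered partition (B_1 | ... | B_k) of [n] into nonempty blocks is
-- encoded by the surjective block-index map b : Fin n → Fin k
-- (u ∈ B_{b u + 1}); surjectivity = blocks nonempty.
-- ≺_π :  u ≺ v  iff  u = v  or  block(u) strictly before block(v).
_≺[_] : ∀ {n k} → Fin n → (Fin n → Fin k) → Fin n → Set
(u ≺[ b ]) v = (u ≡ v) ⊎ (b u < b v)

WOFP : ∀ {n} → Rel n → Set
WOFP {n} R = ∃[ k ] Σ (Fin n → Fin k) λ b →
  Surjective _≡_ _≡_ b ×
  (∀ u v → (R u v ≡ true → (u ≺[ b ]) v) × ((u ≺[ b ]) v → R u v ≡ true))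

-- T ∈ Sh(R,S) : T = R ∪ S̄ ∪ I ∪ D with I ⊆ [m]×[n̄], D ⊆ [n̄]×[m];
-- i.e. T restricted to [m] is R, restricted to [n̄] is S̄, cross pairs arbitrary.
_∈Sh⟨_,_⟩ : ∀ {m n} → Rel (m + n) → Rel m → Rel n → Set
_∈Sh⟨_,_⟩ {m} {n} T R S =
  (∀ i j → T (i ↑ˡ n) (j ↑ˡ n) ≡ R i j) ×
  (∀ i j → T (m ↑ʳ i) (m ↑ʳ j) ≡ S i j)

Enumerates : ∀ {k p} → (Fin p → Bool) → (Fin k → Fin p) → Set
Enumerates {k} {p} X e =
  (∀ i j → i < j → e i < e j) ×
  (∀ x → (X x ≡ true → ∃[ i ] e i ≡ x) × (∃[ i ] e i ≡ x → X x ≡ true))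

-- T_X ≐ R, where R has size k (so in particular |X| = k).
Restricts : ∀ {k p} → Rel p → (Fin p → Bool) → Rel k → Set
Restricts {k} {p} T X R =
  Σ (Fin k → Fin p) λ e → Enumerates X e × (∀ i j → T (e i) (e j) ≡ R i j)

TotalCut : ∀ {p} → Rel p → (Fin p → Bool) → Set
TotalCut T X = ∀ x y → X x ≡ true → X y ≡ false → (T x y ≡ true) × (T y x ≡ false)

_∈⋆⟨_,_⟩ : ∀ {m n} → Rel (m + n) → Rel m → Rel n → Set
T ∈⋆⟨ R , S ⟩ = Σ _ λ X → TotalCut T X × Restricts T X R × Restricts T (not ∘ X) S

{-# OPTIONS --safe #-}
-- A relation R is a weak order ≺_π exactly when some rank function f satisfies
-- R u v ⇔ u = v ∨ f u < f v: the rank function need not be onto, since unused ranks can be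
-- squeezed out.  Pulling a ranked relation back along an injection keeps it ranked, which
-- gives (i) and, by contraposition, (iii).  A total cut exhibits T as the ordinal sum of its
-- two restrictions, and an ordinal sum of ranked relations is ranked by placing the ranks of
-- the second summand after those of the first, which gives (ii).  For (iv), the contrapositive
-- of (ii), it is decided which factor fails to be WOFP by searching all rank functions
-- [n] → [n].
module Submission where

open import Defs
open import Data.Product using (Σ; ∃; ∃-syntax; _×_)
open import Data.Sum using (_⊎_)
open import Relation.Nullary using (¬_)

open import Data.Bool using (Bool; true; false; not)
import Data.Bool as Bool
open import Data.Bool.Properties using (not-injective)
open import Data.Empty using (⊥-elim)
open import Data.Fin using (Fin; zero; suc; toℕ; _<_; _≟_; _<?_; punchOut; inject≤; _↑ˡ_; _↑ʳ_)
open import Data.Fin.Properties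
  using (any?; all?; ¬∀⟶∃¬; toℕ<n; toℕ-↑ˡ; toℕ-↑ʳ; toℕ-inject≤; ↑ˡ-injective; ↑ʳ-injective;
         punchOut-mono-≤; punchOut-cancel-≤; injective⇒≤)
open import Data.Nat as ℕ using (ℕ; _+_)
import Data.Nat.Properties as ℕ
open import Data.Product using (_,_; proj₁; proj₂)
import Data.Product as Product
open import Data.Sum using (inj₁; inj₂; [_,_]; [_,_]′)
import Data.Sum as Sum
open import Data.Sum.Properties using (inj₁-injective; inj₂-injective)
open import Data.Vec.Functional using (_∷_; head; tail)
open import Function using (_∘_; id)
open import Function.Definitions using (Injective; Surjective)
open import Function.Consequences.Propositional using (strictlySurjective⇒surjective)
open import Relation.Binary.PropositionalEquality using (_≡_; _≢_; refl; sym; trans; cong; cong₂; subst₂)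
open import Relation.Nullary using (Dec; yes; no)
open import Relation.Nullary.Decidable using (map′; _×-dec_; _⊎-dec_; _→-dec_)

private
  variable
    A B : Set
    k l m n p : ℕ

section-injective : {f : A → B} {g : B → A} → (∀ y → f (g y) ≡ y) → Injective _≡_ _≡_ g
section-injective {f = f} f∘g≡id {x} {y} gx≡gy =
  trans (sym (f∘g≡id x)) (trans (cong f gx≡gy) (f∘g≡id y))

infix 4 _RankedBy_

_RankedBy_ : (A → A → Bool) → (A → Fin k) → Set
R RankedBy f = ∀ u v → (R u v ≡ true → u ≡ v ⊎ f u < f v) × (u ≡ v ⊎ f u < f v → R u v ≡ true)

SameOrder : (A → Fin k) → (A → Fin l) → Set
SameOrder f g = ∀ u v → (f u < f v → g u < g v) × (g u < g v → f u < f v)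

sameOrder-trans : {f : A → Fin k} {g : A → Fin l} {h : A → Fin m} →
                  SameOrder f g → SameOrder g h → SameOrder f h
sameOrder-trans fg gh u v = proj₁ (gh u v) ∘ proj₁ (fg u v) , proj₂ (fg u v) ∘ proj₂ (gh u v)

sameOrder-toℕ : {f : A → Fin k} {g : A → Fin l} → (∀ u → toℕ (f u) ≡ toℕ (g u)) → SameOrder f g
sameOrder-toℕ eq u v = subst₂ ℕ._<_ (eq u) (eq v) , subst₂ ℕ._<_ (sym (eq u)) (sym (eq v))

rankedBy-sameOrder : {R : A → A → Bool} {f : A → Fin k} {g : A → Fin l} →
                     SameOrder f g → R RankedBy f → R RankedBy g
rankedBy-sameOrder fg ranked u v =
  Sum.map₂ (proj₁ (fg u v)) ∘ proj₁ (ranked u v) , proj₂ (ranked u v) ∘ Sum.map₂ (proj₂ (fg u v))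

rankedBy-restrict : {R : A → A → Bool} {S : B → B → Bool} {f : A → Fin k} {ι : B → A} →
                    Injective _≡_ _≡_ ι → (∀ u v → R (ι u) (ι v) ≡ S u v) →
                    R RankedBy f → S RankedBy (f ∘ ι)
rankedBy-restrict {ι = ι} ι-injective R∘ι≡S ranked u v =
  Sum.map₁ ι-injective ∘ proj₁ (ranked (ι u) (ι v)) ∘ trans (R∘ι≡S u v) ,
  trans (sym (R∘ι≡S u v)) ∘ proj₂ (ranked (ι u) (ι v)) ∘ Sum.map₁ (cong ι)

punchOut-mono-< : {i j k : Fin (ℕ.suc n)} (i≢j : i ≢ j) (i≢k : i ≢ k) →
                  j < k → punchOut i≢j < punchOut i≢k
punchOut-mono-< i≢j i≢k j<k = ℕ.≰⇒> (ℕ.<⇒≱ j<k ∘ punchOut-cancel-≤ i≢k i≢j)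

punchOut-cancel-< : {i j k : Fin (ℕ.suc n)} (i≢j : i ≢ j) (i≢k : i ≢ k) →
                    punchOut i≢j < punchOut i≢k → j < k
punchOut-cancel-< i≢j i≢k j′<k′ = ℕ.≰⇒> (ℕ.<⇒≱ j′<k′ ∘ punchOut-mono-≤ i≢k i≢j)

punchOut-missed : (f : A → Fin (ℕ.suc k)) (j : Fin (ℕ.suc k)) → (∀ u → j ≢ f u) →
                  Σ (A → Fin k) (SameOrder f)
punchOut-missed f j j≢f =
  (λ u → punchOut (j≢f u)) ,
  λ u v → punchOut-mono-< (j≢f u) (j≢f v) , punchOut-cancel-< (j≢f u) (j≢f v)

compress : (f : Fin p → Fin k) →
           ∃[ l ] Σ (Fin p → Fin l) λ g → Surjective _≡_ _≡_ g × SameOrder f g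
compress {k = ℕ.zero} f = _ , f , (λ ()) , λ _ _ → id , id
compress {k = ℕ.suc k} f with all? (λ y → any? (λ x → f x ≟ y))
... | yes hit = _ , f , strictlySurjective⇒surjective hit , λ _ _ → id , id
... | no ¬hit =
  let (j , missed) = ¬∀⟶∃¬ _ _ (λ y → any? (λ x → f x ≟ y)) ¬hit
      (f′ , f~f′) = punchOut-missed f j (λ u j≡fu → missed (u , sym j≡fu))
      (l , g , g-surjective , f′~g) = compress f′
  in l , g , g-surjective , sameOrder-trans f~f′ f′~g

rankedBy⇒WOFP : {R : Rel p} {f : Fin p → Fin k} → R RankedBy f → WOFP R
rankedBy⇒WOFP {f = f} ranked =
  let (l , g , g-surjective , f~g) = compress f
  in l , g , g-surjective , rankedBy-sameOrder f~g ranked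

WOFP-restrict : {R : Rel p} {S : Rel n} {ι : Fin n → Fin p} →
                Injective _≡_ _≡_ ι → (∀ u v → R (ι u) (ι v) ≡ S u v) → WOFP R → WOFP S
WOFP-restrict ι-injective R∘ι≡S (_ , _ , _ , ranked) =
  rankedBy⇒WOFP (rankedBy-restrict ι-injective R∘ι≡S ranked)

Sh∩WOFP⇒WOFP : {P : Rel m} {Q : Rel n} → (∃[ T ] (T ∈Sh⟨ P , Q ⟩ × WOFP T)) → WOFP P × WOFP Q
Sh∩WOFP⇒WOFP {m} {n} (T , (T↑ˡ≡P , T↑ʳ≡Q) , T-WOFP) =
  WOFP-restrict (↑ˡ-injective n _ _) T↑ˡ≡P T-WOFP ,
  WOFP-restrict (↑ʳ-injective m _ _) T↑ʳ≡Q T-WOFP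

infixr 6 _⊕_ _⊕ʳ_

_⊕_ : Rel m → Rel n → Fin m ⊎ Fin n → Fin m ⊎ Fin n → Bool
(P ⊕ Q) (inj₁ i) (inj₁ j) = P i j
(P ⊕ Q) (inj₁ i) (inj₂ j) = true
(P ⊕ Q) (inj₂ i) (inj₁ j) = false
(P ⊕ Q) (inj₂ i) (inj₂ j) = Q i j

_⊕ʳ_ : (Fin m → Fin k) → (Fin n → Fin l) → Fin m ⊎ Fin n → Fin (k + l)
_⊕ʳ_ {k = k} {l = l} f g = [ (_↑ˡ l) ∘ f , (k ↑ʳ_) ∘ g ]

↑ˡ-mono-< : ∀ l {i j : Fin k} → i < j → i ↑ˡ l < j ↑ˡ l
↑ˡ-mono-< l {i} {j} = subst₂ ℕ._<_ (sym (toℕ-↑ˡ i l)) (sym (toℕ-↑ˡ j l))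

↑ˡ-cancel-< : ∀ l {i j : Fin k} → i ↑ˡ l < j ↑ˡ l → i < j
↑ˡ-cancel-< l {i} {j} = subst₂ ℕ._<_ (toℕ-↑ˡ i l) (toℕ-↑ˡ j l)

↑ʳ-mono-< : ∀ k {i j : Fin l} → i < j → k ↑ʳ i < k ↑ʳ j
↑ʳ-mono-< k {i} {j} = subst₂ ℕ._<_ (sym (toℕ-↑ʳ k i)) (sym (toℕ-↑ʳ k j)) ∘ ℕ.+-monoʳ-< k

↑ʳ-cancel-< : ∀ k {i j : Fin l} → k ↑ʳ i < k ↑ʳ j → i < j
↑ʳ-cancel-< k {i} {j} = ℕ.+-cancelˡ-< k _ _ ∘ subst₂ ℕ._<_ (toℕ-↑ʳ k i) (toℕ-↑ʳ k j)

↑ˡ<↑ʳ : (i : Fin k) (j : Fin l) → i ↑ˡ l < k ↑ʳ j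
↑ˡ<↑ʳ {k} {l} i j = subst₂ ℕ._<_ (sym (toℕ-↑ˡ i l)) (sym (toℕ-↑ʳ k j))
  (ℕ.<-≤-trans (toℕ<n i) (ℕ.m≤m+n k (toℕ j)))

⊕-rankedBy : {P : Rel m} {Q : Rel n} {f : Fin m → Fin k} {g : Fin n → Fin l} →
             P RankedBy f → Q RankedBy g → (P ⊕ Q) RankedBy (f ⊕ʳ g)
⊕-rankedBy {l = l} P-ranked Q-ranked (inj₁ i) (inj₁ j) =
  Sum.map (cong inj₁) (↑ˡ-mono-< l) ∘ proj₁ (P-ranked i j) ,
  proj₂ (P-ranked i j) ∘ Sum.map inj₁-injective (↑ˡ-cancel-< l)
⊕-rankedBy P-ranked Q-ranked (inj₁ i) (inj₂ j) = (λ _ → inj₂ (↑ˡ<↑ʳ _ _)) , (λ _ → refl)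
⊕-rankedBy P-ranked Q-ranked (inj₂ i) (inj₁ j) =
  (λ ()) , [ (λ ()) , (λ j<i → ⊥-elim (ℕ.<-asym j<i (↑ˡ<↑ʳ _ _))) ]
⊕-rankedBy {k = k} P-ranked Q-ranked (inj₂ i) (inj₂ j) =
  Sum.map (cong inj₂) (↑ʳ-mono-< k) ∘ proj₁ (Q-ranked i j) ,
  proj₂ (Q-ranked i j) ∘ Sum.map inj₂-injective (↑ʳ-cancel-< k)

⋆⇒⊕-relabelling : {P : Rel m} {Q : Rel n} {T : Rel (m + n)} → T ∈⋆⟨ P , Q ⟩ →
                  Σ (Fin (m + n) → Fin m ⊎ Fin n) λ s →
                    Injective _≡_ _≡_ s × (∀ x y → (P ⊕ Q) (s x) (s y) ≡ T x y)
⋆⇒⊕-relabelling {m} {n} {P} {Q} {T}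
  (X , cut , (e , (_ , X-cover) , T∘e≡P) , (e′ , (_ , Y-cover) , T∘e′≡Q)) =
  s , section-injective {f = σ} σ∘s≡id ,
  λ x y → trans (sym (σ-respects (s x) (s y))) (cong₂ T (σ∘s≡id x) (σ∘s≡id y))
  where
  σ : Fin m ⊎ Fin n → Fin (m + n)
  σ = [ e , e′ ]

  σ-onto : ∀ x → ∃ λ α → σ α ≡ x
  σ-onto x with X x in eq
  ... | true = Product.map inj₁ id (proj₁ (X-cover x) eq)
  ... | false = Product.map inj₂ id (proj₁ (Y-cover x) (cong not eq))

  s : Fin (m + n) → Fin m ⊎ Fin n
  s = proj₁ ∘ σ-onto

  σ∘s≡id : ∀ x → σ (s x) ≡ x
  σ∘s≡id = proj₂ ∘ σ-onto

  e∈X : ∀ i → X (e i) ≡ true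
  e∈X i = proj₂ (X-cover (e i)) (i , refl)

  e′∉X : ∀ j → X (e′ j) ≡ false
  e′∉X j = not-injective (proj₂ (Y-cover (e′ j)) (j , refl))

  σ-respects : ∀ α β → T (σ α) (σ β) ≡ (P ⊕ Q) α β
  σ-respects (inj₁ i) (inj₁ j) = T∘e≡P i j
  σ-respects (inj₁ i) (inj₂ j) = proj₁ (cut (e i) (e′ j) (e∈X i) (e′∉X j))
  σ-respects (inj₂ i) (inj₁ j) = proj₂ (cut (e j) (e′ i) (e∈X j) (e′∉X i))
  σ-respects (inj₂ i) (inj₂ j) = T∘e′≡Q i j

⋆-preserves-WOFP : {P : Rel m} {Q : Rel n} {T : Rel (m + n)} →
                   WOFP P → WOFP Q → T ∈⋆⟨ P , Q ⟩ → WOFP T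
⋆-preserves-WOFP (_ , _ , _ , P-ranked) (_ , _ , _ , Q-ranked) T∈P⋆Q =
  let (s , s-injective , ⊕∘s≡T) = ⋆⇒⊕-relabelling T∈P⋆Q
  in rankedBy⇒WOFP (rankedBy-restrict s-injective ⊕∘s≡T (⊕-rankedBy P-ranked Q-ranked))

any-function? : {P : (Fin n → Fin k) → Set} → (∀ {f g} → (∀ i → f i ≡ g i) → P f → P g) →
                (∀ f → Dec (P f)) → Dec (∃ P)
any-function? {n = ℕ.zero} resp P? = map′ (_ ,_) (λ (f , Pf) → resp (λ ()) Pf) (P? (λ ()))
any-function? {n = ℕ.suc n} resp P? =
  map′ (λ (a , f , Pa∷f) → a ∷ f , Pa∷f)
       (λ (f , Pf) → head f , tail f , resp (λ { zero → refl ; (suc i) → refl }) Pf)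
       (any? λ a → any-function? (λ f≗g → resp (λ { zero → refl ; (suc i) → f≗g i })) (P? ∘ (a ∷_)))

rankedBy? : (R : Rel p) (f : Fin p → Fin k) → Dec (R RankedBy f)
rankedBy? R f = all? λ u → all? λ v →
  ((R u v Bool.≟ true) →-dec ≺? u v) ×-dec (≺? u v →-dec (R u v Bool.≟ true))
  where
  ≺? : ∀ u v → Dec (u ≡ v ⊎ f u < f v)
  ≺? u v = (u ≟ v) ⊎-dec (f u <? f v)

WOFP⇒rankedBy-endo : {R : Rel p} → WOFP R → ∃ λ (f : Fin p → Fin p) → R RankedBy f
WOFP⇒rankedBy-endo {p} (k , b , b-surjective , ranked) =
  (λ u → inject≤ (b u) k≤p) ,
  rankedBy-sameOrder (sameOrder-toℕ (λ u → sym (toℕ-inject≤ (b u) k≤p))) ranked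
  where
  k≤p : k ℕ.≤ p
  k≤p = injective⇒≤ (section-injective {f = b} (λ y → proj₂ (b-surjective y) refl))

WOFP? : (R : Rel p) → Dec (WOFP R)
WOFP? R = map′ (rankedBy⇒WOFP ∘ proj₂) WOFP⇒rankedBy-endo
  (any-function? (λ f≗g → rankedBy-sameOrder (sameOrder-toℕ (cong toℕ ∘ f≗g))) (rankedBy? R))

¬×⇒¬⊎¬ : {P Q : Set} → Dec P → Dec Q → ¬ (P × Q) → ¬ P ⊎ ¬ Q
¬×⇒¬⊎¬ (yes p) (yes q) ¬pq = ⊥-elim (¬pq (p , q))
¬×⇒¬⊎¬ (no ¬p) _ _ = inj₁ ¬p
¬×⇒¬⊎¬ (yes _) (no ¬q) _ = inj₂ ¬q

mainTheorem15 : ∀ {m n} (P : Rel m) (Q : Rel n) → IPos P → IPos Q →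
    ((∃[ T ] (T ∈Sh⟨ P , Q ⟩ × WOFP T)) → WOFP P × WOFP Q) ×
    (WOFP P → WOFP Q → ∀ T → T ∈⋆⟨ P , Q ⟩ → WOFP T) ×
    ((¬ WOFP P ⊎ ¬ WOFP Q) → ∀ T → T ∈Sh⟨ P , Q ⟩ → IPos T → ¬ WOFP T) ×
    (∀ T → IPos T → ¬ WOFP T → T ∈⋆⟨ P , Q ⟩ → ¬ WOFP P ⊎ ¬ WOFP Q)
mainTheorem15 P Q _ _ =
  Sh∩WOFP⇒WOFP ,
  (λ P-WOFP Q-WOFP _ → ⋆-preserves-WOFP P-WOFP Q-WOFP) ,
  (λ ¬P⊎¬Q T T∈Sh _ T-WOFP →
    [ _∘ proj₁ , _∘ proj₂ ]′ ¬P⊎¬Q (Sh∩WOFP⇒WOFP (T , T∈Sh , T-WOFP))) ,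
  (λ T _ ¬T-WOFP T∈P⋆Q →
    ¬×⇒¬⊎¬ (WOFP? P) (WOFP? Q)
      (λ (P-WOFP , Q-WOFP) → ¬T-WOFP (⋆-preserves-WOFP P-WOFP Q-WOFP T∈P⋆Q)))
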